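{- Let $h=\langle O,\mathit{po},\mathit{rf}\rangle$ be a history, $\mathit{ww}$ a store order, and $\mathit{tw}$ a strict total order on $\mathit{WR}(O)$ with $\mathit{ww}\subseteq\mathit{tw}$. Let $\mathit{fr}=\mathit{rf}^{ -1}\circ\mathit{ww}$. If $G^{\mathit{ww}}_{loc}=(O,\mathit{po}\text{ - }\mathit{loc}\cup\mathit{rf}\cup\mathit{ww}\cup\mathit{fr})$ is acyclic, then so is $G^{\mathit{tw}}_{loc}=(O,\mathit{po}\text{ - }\mathit{loc}\cup\mathit{rf}\cup\mathit{tw}\cup\mathit{fr})$.
   Context: Events are writes $\mathit{wr}(x,v)$ and reads $\mathit{rd}(x,v)$ on variables $x\in\mathit{Var}$; $\mathit{var}(o)$ is the variable of $o$. A history $h=\langle O,\mathit{po},\mathit{rf}\rangle$: $O$ a finite set of events, $\mathit{po}$ a strict partial order on $O$, $\mathit{rf}\subseteq\mathit{WR}(O)\times\mathit{RD}(O)$ with every read having an $\mathit{rf}$-predecessor write and $\mathit{rf}$-related events on the same variable. $\mathit{po}\text{ - }\mathit{loc}=\{(o,o')\in\mathit{po}:\mathit{var}(o)=\mathit{var}(o')\}$. A store order is a relation $\mathit{ww}=\bigcup_{x\in\mathit{Var}}\mathit{ww}_x$ where each $\mathit{ww}_x$ is a strict total order on the set $\mathit{WR}(x)$ of write events of $h$ on variable $x$. -}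

module Defs where

open import Level using (Level; _⊔_; suc)
open import Data.Product using (_×_; Σ; ∃; _,_)
open import Data.Sum using (_⊎_)
open import Data.List using (List)
open import Data.List.Membership.Propositional using (_∈_)
open import Relation.Binary.PropositionalEquality using (_≡_)
open import Relation.Binary.Construct.Closure.Transitive using (TransClosure)
open import Relation.Nullary using (¬_)

data Kind : Set where
  wr rd : Kind

Rel : Set → Set₁
Rel A = A → A → Set

-- Each event o has a kind, variable var o and value val o
-- (so o is wr(var o, val o) or rd(var o, val o)).
record History (Var Val : Set) : Set₁ where
  field
    O       : Set
    events  : List O
    finite  : ∀ (o : O) → o ∈ events
    kind    : O → Kind
    var     : O → Var
    val     : O → Val
    po      : Rel O
    po-irrefl : ∀ o → ¬ po o o
    po-trans  : ∀ {a b c} → po a b → po b c → po a c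
    rf      : Rel O
    rf-wr   : ∀ {w r} → rf w r → kind w ≡ wr
    rf-rd   : ∀ {w r} → rf w r → kind r ≡ rd
    rf-var  : ∀ {w r} → rf w r → var w ≡ var r
    rf-total : ∀ r → kind r ≡ rd → ∃ λ w → rf w r

  IsWrite : O → Set
  IsWrite o = kind o ≡ wr

  IsWriteOn : Var → O → Set
  IsWriteOn x o = (kind o ≡ wr) × (var o ≡ x)

  po-loc : Rel O
  po-loc a b = po a b × (var a ≡ var b)

open History public

record StrictTotalOn {A : Set} (P : A → Set) (R : Rel A) : Set where
  field
    dom    : ∀ {a b} → R a b → P a × P b
    irrefl : ∀ a → ¬ R a a
    trans  : ∀ {a b c} → R a b → R b c → R a c
    total  : ∀ a b → P a → P b → R a b ⊎ (a ≡ b) ⊎ R b a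

-- A store order: ww = ⋃_x ww_x with each ww_x a strict total order on WR(x).
record StoreOrder {Var Val : Set} (h : History Var Val) (ww : Rel (O h)) : Set where
  field
    same-var  : ∀ {a b} → ww a b → var h a ≡ var h b
    per-var   : ∀ (x : Var) →
                StrictTotalOn (IsWriteOn h x) (λ a b → ww a b × var h a ≡ x)

_∪_ : {A : Set} → Rel A → Rel A → Rel A
(R ∪ S) a b = R a b ⊎ S a b
infixr 5 _∪_

_⨾_ : {A : Set} → Rel A → Rel A → Rel A
(R ⨾ S) a c = ∃ λ b → R a b × S b c

_⁻¹ : {A : Set} → Rel A → Rel A
(R ⁻¹) a b = R b a

fr : {Var Val : Set} (h : History Var Val) → Rel (O h) → Rel (O h)
fr h ww = (rf h ⁻¹) ⨾ ww

Acyclic : {A : Set} → Rel A → Set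
Acyclic E = ∀ a → ¬ TransClosure E a a

G-loc : {Var Val : Set} (h : History Var Val) (ww tw : Rel (O h)) → Rel (O h)
G-loc h ww tw = po-loc h ∪ rf h ∪ tw ∪ fr h ww

-- Every G_loc^ww-path between two writes stays on one variable, so by totality of ww and
-- acyclicity it is a ww-edge, hence a tw-edge. A cycle of G_loc^tw using some tw-edge
-- therefore collapses, segment by segment, into a tw-cycle on writes, which is impossible;
-- a cycle using none is a G_loc^ww-cycle.
module Submission where

open import Data.Empty using (⊥-elim)
open import Data.Product using (_×_; ∃₂; _,_; proj₁; proj₂)
open import Data.Sum using (_⊎_; inj₁; inj₂)
open import Relation.Binary.PropositionalEquality using (_≡_; refl; sym; trans)
open import Relation.Binary.Construct.Closure.Transitive using (TransClosure; [_]; _∷_; _∷ʳ_)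
open import Relation.Binary.Construct.Closure.ReflexiveTransitive using (Star; ε; _◅_; _◅◅_)
open import Relation.Nullary using (¬_)

open import Defs

module _ {A : Set} where

  TransClosure-mono : {R S : Rel A} → (∀ {a b} → R a b → S a b) →
                      ∀ {a b} → TransClosure R a b → TransClosure S a b
  TransClosure-mono R⊆S [ r ]     = [ R⊆S r ]
  TransClosure-mono R⊆S (r ∷ rs) = R⊆S r ∷ TransClosure-mono R⊆S rs

  Acyclic-mono : {R S : Rel A} → (∀ {a b} → R a b → S a b) → Acyclic S → Acyclic R
  Acyclic-mono R⊆S acyclic a cycle = acyclic a (TransClosure-mono R⊆S cycle)

  ⁺⇒* : {R : Rel A} → ∀ {a b} → TransClosure R a b → Star R a b
  ⁺⇒* [ r ]     = r ◅ ε
  ⁺⇒* (r ∷ rs) = r ◅ ⁺⇒* rs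

  ◅⁺ : {R : Rel A} → ∀ {a b c} → R a b → Star R b c → TransClosure R a c
  ◅⁺ r ε        = [ r ]
  ◅⁺ r (r′ ◅ rs) = r ∷ ◅⁺ r′ rs

module AcyclicUnionOrder
  {A : Set} (E T : Rel A) (P : A → Set)
  (T-dom    : ∀ {a b} → T a b → P a × P b)
  (T-irrefl : ∀ a → ¬ T a a)
  (T-trans  : ∀ {a b c} → T a b → T b c → T a c)
  (E⁺⊆T     : ∀ {a b} → P a → P b → TransClosure E a b → T a b)
  (E-acyclic : Acyclic E)
  where

  ThroughT : Rel A
  ThroughT a c = ∃₂ λ w w′ → Star E a w × T w w′ × Star E w′ c

  T⨾E*⊆T : ∀ {a b c} → T a b → Star E b c → P c → T a c
  T⨾E*⊆T t ε        _  = t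
  T⨾E*⊆T t (e ◅ es) Pc = T-trans t (E⁺⊆T (proj₂ (T-dom t)) Pc (◅⁺ e es))

  factor : ∀ {a c} → TransClosure (E ∪ T) a c → TransClosure E a c ⊎ ThroughT a c
  factor [ inj₁ e ] = inj₁ [ e ]
  factor [ inj₂ t ] = inj₂ (_ , _ , ε , t , ε)
  factor (inj₁ e ∷ p) with factor p
  ... | inj₁ es                      = inj₁ (e ∷ es)
  ... | inj₂ (w , w′ , s , t , s′) = inj₂ (w , w′ , e ◅ s , t , s′)
  factor (inj₂ t ∷ p) with factor p
  ... | inj₁ es                       = inj₂ (_ , _ , ε , t , ⁺⇒* es)
  ... | inj₂ (w , w′ , s , t′ , s′) =
    inj₂ (_ , w′ , ε , T-trans (T⨾E*⊆T t s (proj₁ (T-dom t′))) t′ , s′)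

  acyclic : Acyclic (E ∪ T)
  acyclic a cycle with factor cycle
  ... | inj₁ es                      = E-acyclic a es
  ... | inj₂ (w , w′ , s , t , s′) = T-irrefl w (T⨾E*⊆T t (s′ ◅◅ s) (proj₁ (T-dom t)))

module _ {Var Val : Set} (h : History Var Val) {ww : Rel (O h)} (so : StoreOrder h ww) where

  open StoreOrder so

  G-loc-edge-var : ∀ {a b} → G-loc h ww ww a b → var h a ≡ var h b
  G-loc-edge-var (inj₁ (_ , same))                  = same
  G-loc-edge-var (inj₂ (inj₁ r))                    = rf-var h r
  G-loc-edge-var (inj₂ (inj₂ (inj₁ w)))             = same-var w
  G-loc-edge-var (inj₂ (inj₂ (inj₂ (_ , r , w)))) = trans (sym (rf-var h r)) (same-var w)

  G-loc-path-var : ∀ {a b} → TransClosure (G-loc h ww ww) a b → var h a ≡ var h b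
  G-loc-path-var [ e ]    = G-loc-edge-var e
  G-loc-path-var (e ∷ p) = trans (G-loc-edge-var e) (G-loc-path-var p)

  write-path⇒ww : Acyclic (G-loc h ww ww) →
                  ∀ {w w′} → IsWrite h w → IsWrite h w′ →
                  TransClosure (G-loc h ww ww) w w′ → ww w w′
  write-path⇒ww acyclic {w} {w′} Ww Ww′ p
    with StrictTotalOn.total (per-var (var h w)) w w′ (Ww , refl) (Ww′ , sym (G-loc-path-var p))
  ... | inj₁ (w<w′ , _)        = w<w′
  ... | inj₂ (inj₁ refl)       = ⊥-elim (acyclic w p)
  ... | inj₂ (inj₂ (w′<w , _)) = ⊥-elim (acyclic w (p ∷ʳ inj₂ (inj₂ (inj₁ w′<w))))

G-loc-⊆-∪ : {Var Val : Set} (h : History Var Val) (ww tw : Rel (O h)) →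
            ∀ {a b} → G-loc h ww tw a b → (G-loc h ww ww ∪ tw) a b
G-loc-⊆-∪ h ww tw (inj₁ po-edge)               = inj₁ (inj₁ po-edge)
G-loc-⊆-∪ h ww tw (inj₂ (inj₁ rf-edge))        = inj₁ (inj₂ (inj₁ rf-edge))
G-loc-⊆-∪ h ww tw (inj₂ (inj₂ (inj₁ tw-edge))) = inj₂ tw-edge
G-loc-⊆-∪ h ww tw (inj₂ (inj₂ (inj₂ fr-edge))) = inj₁ (inj₂ (inj₂ (inj₂ fr-edge)))

lemma4p2 : {Var Val : Set} (h : History Var Val) (ww tw : Rel (O h)) →
             StoreOrder h ww →
             StrictTotalOn (IsWrite h) tw →
             (∀ {a b} → ww a b → tw a b) →
             Acyclic (G-loc h ww ww) →
             Acyclic (G-loc h ww tw)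
lemma4p2 h ww tw so tw-total ww⊆tw acyclic =
  Acyclic-mono (G-loc-⊆-∪ h ww tw)
    (AcyclicUnionOrder.acyclic (G-loc h ww ww) tw (IsWrite h) TW.dom TW.irrefl TW.trans
      (λ Ww Ww′ p → ww⊆tw (write-path⇒ww h so acyclic Ww Ww′ p))
      acyclic)
  where module TW = StrictTotalOn tw-total
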